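{- Fix $n$. The quantity $\max_{v\in V(B_{n,d})} J(v)$ is strictly increasing in $d$ for $2 \leq d \leq n-1$.
   Context: For a connected graph $G=(V,E)$ and simple random walk on $G$ (each step moves to a uniformly random neighbor), $H(u,v)$ is the expected number of steps for the walk from $u$ to reach $v$, with $H(u,u)=0$. The joining time to $v$ is $J(v)=\sum_{u\in V}\deg(u)H(u,v)$. For $2\le d<n$, the broom $B_{n,d}$ is the tree on $n$ vertices consisting of a path $v_1,\ldots,v_d$ (the handle) together with $n-d$ leaves (the bristles) all adjacent to $v_1$. -}

module Defs where

open import Data.Nat as ℕ using (ℕ; zero; suc; _<ᵇ_; _≡ᵇ_)
open import Data.Bool using (Bool; true; false; _∧_; _∨_; if_then_else_)
open import Data.Fin using (Fin; toℕ)
open import Data.List using (List; []; _∷_; map; foldr; filter)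
open import Data.List.Base using (allFin)
open import Data.Rational using (ℚ; 0ℚ; 1ℚ; _+_; _*_; _⊔_; _<_)
open import Relation.Binary.PropositionalEquality using (_≡_)
open import Relation.Nullary.Decidable using ()
open import Data.Product using (_×_)

-- Vertices of the broom B_{n,d} are Fin n, identified via toℕ with 0..n-1.
-- Handle v_1,...,v_d is 0,...,d-1 (v_1 = 0); bristles are d,...,n-1, all adjacent to 0.

broomAdjℕ : ℕ → ℕ → ℕ → Bool
broomAdjℕ d i j =
     ((i <ᵇ d) ∧ (j <ᵇ d) ∧ ((suc i ≡ᵇ j) ∨ (suc j ≡ᵇ i)))
  ∨ ((i ≡ᵇ 0) ∧ (d ℕ.≤ᵇ j))
  ∨ ((j ≡ᵇ 0) ∧ (d ℕ.≤ᵇ i))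

adj : (n d : ℕ) → Fin n → Fin n → Bool
adj n d u w = broomAdjℕ d (toℕ u) (toℕ w)

Σᵥ : (n : ℕ) → (Fin n → ℚ) → ℚ
Σᵥ n f = foldr _+_ 0ℚ (map f (allFin n))

-- maximum of a rational-valued function over all vertices (0 if n = 0)
maxᵥ : (n : ℕ) → (Fin n → ℚ) → ℚ
maxᵥ zero f = 0ℚ
maxᵥ (suc n) f = foldr _⊔_ (f Fin.zero) (map f (allFin (suc n)))
  where import Data.Fin as Fin

indicator : Bool → ℚ
indicator true = 1ℚ
indicator false = 0ℚ

deg : (n d : ℕ) → Fin n → ℚ
deg n d u = Σᵥ n (λ w → indicator (adj n d u w))

-- h is the hitting-time function of simple random walk on B_{n,d}:
-- H(v,v) = 0 and, for u ≠ v, H(u,v) = 1 + (1/deg u) Σ_{w ~ u} H(w,v),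
-- written multiplied through by deg u.  (This first-step system has a
-- unique solution on a connected graph, namely the expected hitting times.)
IsHittingTime : (n d : ℕ) → (Fin n → Fin n → ℚ) → Set
IsHittingTime n d h =
  ((v : Fin n) → h v v ≡ 0ℚ) ×
  ((u v : Fin n) → (u ≡ v → Data.Empty.⊥) →
     deg n d u * h u v ≡ deg n d u + Σᵥ n (λ w → indicator (adj n d u w) * h w v))
  where import Data.Empty

J : (n d : ℕ) → (Fin n → Fin n → ℚ) → Fin n → ℚ
J n d h v = Σᵥ n (λ u → deg n d u * h u v)

maxJ : (n d : ℕ) → (Fin n → Fin n → ℚ) → ℚ
maxJ n d h = maxᵥ n (J n d h)

{-# OPTIONS --safe #-}

-- On a tree, J(v) = Σₑ (2 mₑ + 1)², where mₑ is the number of edges beyond e as seen from v: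
-- walking along a path towards v, the first-step equations telescope one edge at a time, and
-- each edge contributes the square of the total degree 2 mₑ + 1 of the part of the tree behind it.
-- For the broom with b = n - d bristles and a handle of d - 1 edges every vertex is dominated by
-- the tip of the handle, where J = b + Σ_{j < d-1} (2b + 1 + 2j)².  Moving one bristle onto the
-- handle (d ↦ d + 1) changes this value by (2b - 1)² - 1, which is positive because b ≥ 2.

module Submission where

open import Defs
open import Data.Bool using (true; false; T; _∧_; _∨_)
open import Data.Empty using (⊥-elim)
open import Data.Fin as Fin using (Fin; toℕ; fromℕ<)
import Data.Fin.Properties as Fin
open import Data.List using ([]; _∷_; map; foldr; allFin; tabulate)
open import Data.List.Membership.Propositional.Properties using (∈-allFin)
open import Data.List.Properties using (map-tabulate; foldr-preservesᵇ; foldr-preservesᵒ)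
import Data.List.Relation.Unary.All.Properties as All
import Data.List.Relation.Unary.Any as Any
import Data.List.Relation.Unary.Any.Properties as Any
open import Data.Maybe using (Maybe; just; nothing)
open import Data.Nat as ℕ using (ℕ; zero; suc; z≤n; s≤s; _≤_; _<_; _∸_; _<ᵇ_; _≡ᵇ_)
import Data.Nat.Properties as ℕ
import Data.Nat.Tactic.RingSolver as ℕ-Solver
open import Data.Product using (_×_; _,_; proj₁; proj₂)
open import Data.Rational as ℚ using (ℚ; 0ℚ; 1ℚ; _+_; _*_; _-_; _⊔_)
import Data.Rational
import Data.Rational.Properties as ℚ
open import Data.Sum using (_⊎_; inj₁; inj₂; [_,_]′)
open import Function using (_∘_)
open import Level using (0ℓ)
open import Relation.Binary.PropositionalEquality hiding (J)
open import Relation.Nullary using (¬_; yes; no)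
open import Tactic.RingSolver using (solve-∀; solve)
import Tactic.RingSolver.Core.AlmostCommutativeRing as ACR
open import Algebra.Properties.Group ℚ.+-0-group using () renaming (∙-cancelʳ to +-cancelʳ)

ℚ-ring : ACR.AlmostCommutativeRing 0ℓ 0ℓ
ℚ-ring = ACR.fromCommutativeRing ℚ.+-*-commutativeRing zero?
  where
  zero? : ∀ p → Maybe (0ℚ ≡ p)
  zero? p with 0ℚ ℚ.≟ p
  ... | yes 0≡p = just 0≡p
  ... | no _    = nothing

two : ℚ
two = 1ℚ + 1ℚ

fromℕ : ℕ → ℚ
fromℕ zero    = 0ℚ
fromℕ (suc k) = 1ℚ + fromℕ k

fromℕ-+ : ∀ m n → fromℕ (m ℕ.+ n) ≡ fromℕ m + fromℕ n
fromℕ-+ zero    n = sym (ℚ.+-identityˡ (fromℕ n))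
fromℕ-+ (suc m) n = trans (cong (1ℚ +_) (fromℕ-+ m n)) (sym (ℚ.+-assoc 1ℚ (fromℕ m) (fromℕ n)))

fromℕ-* : ∀ m n → fromℕ (m ℕ.* n) ≡ fromℕ m * fromℕ n
fromℕ-* zero    n = sym (ℚ.*-zeroˡ (fromℕ n))
fromℕ-* (suc m) n = begin
  fromℕ (n ℕ.+ m ℕ.* n)        ≡⟨ fromℕ-+ n (m ℕ.* n) ⟩
  fromℕ n + fromℕ (m ℕ.* n)    ≡⟨ cong₂ _+_ (sym (ℚ.*-identityˡ (fromℕ n))) (fromℕ-* m n) ⟩
  1ℚ * fromℕ n + fromℕ m * fromℕ n ≡⟨ ℚ.*-distribʳ-+ (fromℕ n) 1ℚ (fromℕ m) ⟨
  (1ℚ + fromℕ m) * fromℕ n     ∎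
  where open ≡-Reasoning

fromℕ-nonneg : ∀ n → 0ℚ ℚ.≤ fromℕ n
fromℕ-nonneg zero    = ℚ.≤-refl
fromℕ-nonneg (suc n) = ℚ.+-mono-≤ (ℚ.<⇒≤ (ℚ.positive⁻¹ 1ℚ)) (fromℕ-nonneg n)

fromℕ-mono-≤ : ∀ {m n} → m ≤ n → fromℕ m ℚ.≤ fromℕ n
fromℕ-mono-≤ {n = n} z≤n = fromℕ-nonneg n
fromℕ-mono-≤ (s≤s m≤n) = ℚ.+-monoʳ-≤ 1ℚ (fromℕ-mono-≤ m≤n)

fromℕ-mono-< : ∀ {m n} → m < n → fromℕ m ℚ.< fromℕ n
fromℕ-mono-< {zero}  {suc n} _         = ℚ.+-mono-<-≤ (ℚ.positive⁻¹ 1ℚ) (fromℕ-nonneg n)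
fromℕ-mono-< {suc m} {suc n} (s≤s m<n) = ℚ.+-monoʳ-< 1ℚ (fromℕ-mono-< m<n)

fromℕ-2*+ : ∀ k w → fromℕ (2 ℕ.* k ℕ.+ w) ≡ two * fromℕ k + fromℕ w
fromℕ-2*+ k w = trans (fromℕ-+ (2 ℕ.* k) w) (cong (_+ fromℕ w) (fromℕ-* 2 k))

sumFrom : ℕ → ℕ → (ℕ → ℚ) → ℚ
sumFrom s zero    F = 0ℚ
sumFrom s (suc m) F = F s + sumFrom (suc s) m F

InRange : ℕ → ℕ → ℕ → Set
InRange s m j = s ≤ j × j < s ℕ.+ m

inRange-head : ∀ s m → InRange s (suc m) s
inRange-head s m = ℕ.≤-refl , ℕ.m<m+n s (s≤s z≤n)

inRange-tail : ∀ {s m j} → InRange (suc s) m j → InRange s (suc m) j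
inRange-tail {s} {m} {j} (s<j , j<) = ℕ.<⇒≤ s<j , subst (j <_) (sym (ℕ.+-suc s m)) j<

inRange-empty : ∀ {s j} → ¬ InRange s 0 j
inRange-empty {s} {j} (s≤j , j<s+0) = ℕ.<⇒≱ (subst (j <_) (ℕ.+-identityʳ s) j<s+0) s≤j

inRange-≢-head : ∀ {s m j} → InRange s (suc m) j → s ≢ j → InRange (suc s) m j
inRange-≢-head {s} {m} {j} (s≤j , j<) s≢j = ℕ.≤∧≢⇒< s≤j s≢j , subst (j <_) (ℕ.+-suc s m) j<

inRange-suc⇒≢ : ∀ {s m j} → InRange (suc s) m j → j ≢ s
inRange-suc⇒≢ (s<j , _) = ℕ.<⇒≢ s<j ∘ sym

sumFrom-cong : ∀ {s m F G} → (∀ {j} → InRange s m j → F j ≡ G j) → sumFrom s m F ≡ sumFrom s m G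
sumFrom-cong {s} {zero}  F≗G = refl
sumFrom-cong {s} {suc m} F≗G = cong₂ _+_ (F≗G (inRange-head s m)) (sumFrom-cong (F≗G ∘ inRange-tail))

sumFrom-const : ∀ s m a → sumFrom s m (λ _ → a) ≡ fromℕ m * a
sumFrom-const s zero    a = sym (ℚ.*-zeroˡ a)
sumFrom-const s (suc m) a = begin
  a + sumFrom (suc s) m (λ _ → a) ≡⟨ cong₂ _+_ (sym (ℚ.*-identityˡ a)) (sumFrom-const (suc s) m a) ⟩
  1ℚ * a + fromℕ m * a            ≡⟨ ℚ.*-distribʳ-+ a 1ℚ (fromℕ m) ⟨
  (1ℚ + fromℕ m) * a              ∎
  where open ≡-Reasoning

sumFrom-*ˡ : ∀ s m a F → sumFrom s m (λ j → a * F j) ≡ a * sumFrom s m F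
sumFrom-*ˡ s zero    a F = sym (ℚ.*-zeroʳ a)
sumFrom-*ˡ s (suc m) a F =
  trans (cong (a * F s +_) (sumFrom-*ˡ (suc s) m a F)) (sym (ℚ.*-distribˡ-+ a (F s) _))

sumFrom-++ : ∀ s m m′ F → sumFrom s (m ℕ.+ m′) F ≡ sumFrom s m F + sumFrom (s ℕ.+ m) m′ F
sumFrom-++ s zero    m′ F = trans (cong (λ s′ → sumFrom s′ m′ F) (sym (ℕ.+-identityʳ s)))
                                  (sym (ℚ.+-identityˡ _))
sumFrom-++ s (suc m) m′ F = begin
  F s + sumFrom (suc s) (m ℕ.+ m′) F                          ≡⟨ cong (F s +_) (sumFrom-++ (suc s) m m′ F) ⟩
  F s + (sumFrom (suc s) m F + sumFrom (suc s ℕ.+ m) m′ F)    ≡⟨ ℚ.+-assoc (F s) _ _ ⟨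
  F s + sumFrom (suc s) m F + sumFrom (suc s ℕ.+ m) m′ F
    ≡⟨ cong (λ s′ → F s + sumFrom (suc s) m F + sumFrom s′ m′ F) (ℕ.+-suc s m) ⟨
  F s + sumFrom (suc s) m F + sumFrom (s ℕ.+ suc m) m′ F      ∎
  where open ≡-Reasoning

sumFrom-snoc : ∀ s m F → sumFrom s (suc m) F ≡ sumFrom s m F + F (s ℕ.+ m)
sumFrom-snoc s m F = begin
  sumFrom s (suc m) F                      ≡⟨ cong (λ k → sumFrom s k F) (ℕ.+-comm 1 m) ⟩
  sumFrom s (m ℕ.+ 1) F                    ≡⟨ sumFrom-++ s m 1 F ⟩
  sumFrom s m F + (F (s ℕ.+ m) + 0ℚ)       ≡⟨ cong (sumFrom s m F +_) (ℚ.+-identityʳ _) ⟩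
  sumFrom s m F + F (s ℕ.+ m)              ∎
  where open ≡-Reasoning

sumFrom-zero : ∀ s m → sumFrom s m (λ _ → 0ℚ) ≡ 0ℚ
sumFrom-zero s m = trans (sumFrom-const s m 0ℚ) (ℚ.*-zeroʳ (fromℕ m))

sumFrom-update : ∀ {s m p} F G → InRange s m p → (∀ {j} → InRange s m j → j ≢ p → F j ≡ G j) →
                 sumFrom s m F + G p ≡ sumFrom s m G + F p
sumFrom-update {s} {zero}      F G p∈ agree = ⊥-elim (inRange-empty p∈)
sumFrom-update {s} {suc m} {p} F G p∈ agree with s ℕ.≟ p
... | yes refl = begin
  F s + sumFrom (suc s) m F + G s
    ≡⟨ cong (λ R → F s + R + G s) (sumFrom-cong λ j∈ → agree (inRange-tail j∈) (inRange-suc⇒≢ j∈)) ⟩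
  F s + sumFrom (suc s) m G + G s ≡⟨ swap (F s) _ (G s) ⟩
  G s + sumFrom (suc s) m G + F s ∎
  where
  open ≡-Reasoning
  swap : ∀ x y z → x + y + z ≡ z + y + x
  swap = solve-∀ ℚ-ring
... | no s≢p = begin
  F s + sumFrom (suc s) m F + G p   ≡⟨ ℚ.+-assoc (F s) _ _ ⟩
  F s + (sumFrom (suc s) m F + G p)
    ≡⟨ cong₂ _+_ (agree (inRange-head s m) s≢p) (sumFrom-update F G (inRange-≢-head p∈ s≢p) (agree ∘ inRange-tail)) ⟩
  G s + (sumFrom (suc s) m G + F p) ≡⟨ ℚ.+-assoc (G s) _ _ ⟨
  G s + sumFrom (suc s) m G + F p   ∎
  where open ≡-Reasoning

sumFrom-support₁ : ∀ {s m p} F → InRange s m p → (∀ {j} → InRange s m j → j ≢ p → F j ≡ 0ℚ) →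
                   sumFrom s m F ≡ F p
sumFrom-support₁ {s} {m} {p} F p∈ vanish = begin
  sumFrom s m F                        ≡⟨ ℚ.+-identityʳ _ ⟨
  sumFrom s m F + 0ℚ                   ≡⟨ sumFrom-update F (λ _ → 0ℚ) p∈ vanish ⟩
  sumFrom s m (λ _ → 0ℚ) + F p         ≡⟨ cong (_+ F p) (sumFrom-zero s m) ⟩
  0ℚ + F p                             ≡⟨ ℚ.+-identityˡ (F p) ⟩
  F p                                  ∎
  where open ≡-Reasoning

sumFrom-support₂ : ∀ {s m p q} F → p < q → InRange s m p → InRange s m q →
                   (∀ {j} → InRange s m j → j ≢ p → j ≢ q → F j ≡ 0ℚ) →
                   sumFrom s m F ≡ F p + F q
sumFrom-support₂ {s} {zero}      F p<q p∈ q∈ vanish = ⊥-elim (inRange-empty p∈)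
sumFrom-support₂ {s} {suc m} {p} {q} F p<q p∈ q∈ vanish with s ℕ.≟ p
... | yes refl = cong (F s +_) (sumFrom-support₁ F (inRange-≢-head q∈ (ℕ.<⇒≢ p<q))
                   λ j∈ → vanish (inRange-tail j∈) (inRange-suc⇒≢ j∈))
... | no s≢p = begin
  F s + sumFrom (suc s) m F
    ≡⟨ cong₂ _+_ (vanish (inRange-head s m) s≢p s≢q)
                 (sumFrom-support₂ F p<q (inRange-≢-head p∈ s≢p) (inRange-≢-head q∈ s≢q) (vanish ∘ inRange-tail)) ⟩
  0ℚ + (F p + F q)          ≡⟨ ℚ.+-identityˡ _ ⟩
  F p + F q                 ∎
  where
  open ≡-Reasoning
  s≢q : s ≢ q
  s≢q = ℕ.<⇒≢ (ℕ.≤-<-trans (proj₁ p∈) p<q)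

sumFrom-const-except : ∀ {s m p} F a → InRange s (suc m) p → (∀ {j} → InRange s (suc m) j → j ≢ p → F j ≡ a) →
                       F p ≡ 0ℚ → sumFrom s (suc m) F ≡ fromℕ m * a
sumFrom-const-except {s} {m} {p} F a p∈ off-p at-p = +-cancelʳ a _ _ (begin
  sumFrom s (suc m) F + a            ≡⟨ sumFrom-update F (λ _ → a) p∈ off-p ⟩
  sumFrom s (suc m) (λ _ → a) + F p  ≡⟨ cong₂ _+_ (sumFrom-const s (suc m) a) at-p ⟩
  (1ℚ + fromℕ m) * a + 0ℚ            ≡⟨ regroup (fromℕ m) a ⟩
  fromℕ m * a + a                    ∎)
  where
  open ≡-Reasoning
  regroup : ∀ M a → (1ℚ + M) * a + 0ℚ ≡ M * a + a
  regroup = solve-∀ ℚ-ring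

foldr-+-tabulate : ∀ n (F : Fin n → ℚ) s G → (∀ w → F w ≡ G (s ℕ.+ toℕ w)) →
                   foldr _+_ 0ℚ (tabulate F) ≡ sumFrom s n G
foldr-+-tabulate zero    F s G F≗G = refl
foldr-+-tabulate (suc n) F s G F≗G =
  cong₂ _+_ (trans (F≗G Fin.zero) (cong G (ℕ.+-identityʳ s)))
            (foldr-+-tabulate n (F ∘ Fin.suc) (suc s) G λ w → trans (F≗G (Fin.suc w)) (cong G (ℕ.+-suc s (toℕ w))))

Σᵥ-sumFrom : ∀ n (F : Fin n → ℚ) G → (∀ w → F w ≡ G (toℕ w)) → Σᵥ n F ≡ sumFrom 0 n G
Σᵥ-sumFrom n F G F≗G = trans (cong (foldr _+_ 0ℚ) (map-tabulate (λ w → w) F)) (foldr-+-tabulate n F 0 G F≗G)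

maxᵥ-≤ : ∀ n (F : Fin (suc n) → ℚ) {q} → (∀ w → F w ℚ.≤ q) → maxᵥ (suc n) F ℚ.≤ q
maxᵥ-≤ n F {q} F≤q =
  foldr-preservesᵇ {P = ℚ._≤ q} {f = _⊔_} ℚ.⊔-lub (F≤q Fin.zero) (All.map⁺ {f = F} (All.tabulate⁺ {f = λ w → w} F≤q))

≤-maxᵥ : ∀ n (F : Fin n → ℚ) w → F w ℚ.≤ maxᵥ n F
≤-maxᵥ (suc n) F w = foldr-preservesᵒ {P = F w ℚ.≤_} ≤⊔ (F Fin.zero) (map F (allFin (suc n)))
  (inj₂ (Any.map⁺ (Any.map (λ { refl → ℚ.≤-refl }) (∈-allFin w))))
  where
  ≤⊔ : ∀ p q → F w ℚ.≤ p ⊎ F w ℚ.≤ q → F w ℚ.≤ p ⊔ q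
  ≤⊔ p q (inj₁ ≤p) = ℚ.p≤q⇒p≤q⊔r q ≤p
  ≤⊔ p q (inj₂ ≤q) = ℚ.p≤q⇒p≤r⊔q p ≤q

extend : ∀ {n} → (Fin n → ℚ) → ℕ → ℚ
extend {n} F j with j ℕ.<? n
... | yes j<n = F (fromℕ< j<n)
... | no _    = 0ℚ

extend-toℕ : ∀ {n} (F : Fin n → ℚ) w → extend F (toℕ w) ≡ F w
extend-toℕ {n} F w with toℕ w ℕ.<? n
... | yes w<n = cong F (Fin.fromℕ<-toℕ w w<n)
... | no w≮n  = ⊥-elim (w≮n (Fin.toℕ<n w))

extend-fromℕ< : ∀ {n} (F : Fin n → ℚ) {j} (j<n : j < n) → extend F j ≡ F (fromℕ< j<n)
extend-fromℕ< {n} F {j} j<n with j ℕ.<? n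
... | yes _   = refl
... | no j≮n  = ⊥-elim (j≮n j<n)

-- edgeSquares w k = Σ_{j<k} (w + 2j)²
edgeSquares : ℕ → ℕ → ℕ
edgeSquares w zero    = 0
edgeSquares w (suc k) = w ℕ.* w ℕ.+ edgeSquares (2 ℕ.+ w) k

edgeSquares-+ : ∀ w i m → edgeSquares w (i ℕ.+ m) ≡ edgeSquares w i ℕ.+ edgeSquares (2 ℕ.* i ℕ.+ w) m
edgeSquares-+ w zero    m = refl
edgeSquares-+ w (suc i) m = begin
  w ℕ.* w ℕ.+ edgeSquares (2 ℕ.+ w) (i ℕ.+ m)
    ≡⟨ cong (w ℕ.* w ℕ.+_) (edgeSquares-+ (2 ℕ.+ w) i m) ⟩
  w ℕ.* w ℕ.+ (edgeSquares (2 ℕ.+ w) i ℕ.+ edgeSquares (2 ℕ.* i ℕ.+ (2 ℕ.+ w)) m)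
    ≡⟨ ℕ.+-assoc (w ℕ.* w) _ _ ⟨
  w ℕ.* w ℕ.+ edgeSquares (2 ℕ.+ w) i ℕ.+ edgeSquares (2 ℕ.* i ℕ.+ (2 ℕ.+ w)) m
    ≡⟨ cong (λ w′ → w ℕ.* w ℕ.+ edgeSquares (2 ℕ.+ w) i ℕ.+ edgeSquares w′ m) (shift i w) ⟩
  w ℕ.* w ℕ.+ edgeSquares (2 ℕ.+ w) i ℕ.+ edgeSquares (2 ℕ.* suc i ℕ.+ w) m ∎
  where
  open ≡-Reasoning
  shift : ∀ i w → 2 ℕ.* i ℕ.+ (2 ℕ.+ w) ≡ 2 ℕ.* suc i ℕ.+ w
  shift = ℕ-Solver.solve-∀

edgeSquares-snoc : ∀ w k → edgeSquares w (suc k) ≡ edgeSquares w k ℕ.+ (2 ℕ.* k ℕ.+ w) ℕ.* (2 ℕ.* k ℕ.+ w)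
edgeSquares-snoc w k = begin
  edgeSquares w (suc k)                                  ≡⟨ cong (edgeSquares w) (ℕ.+-comm 1 k) ⟩
  edgeSquares w (k ℕ.+ 1)                                ≡⟨ edgeSquares-+ w k 1 ⟩
  edgeSquares w k ℕ.+ (W ℕ.* W ℕ.+ 0)                    ≡⟨ cong (edgeSquares w k ℕ.+_) (ℕ.+-identityʳ (W ℕ.* W)) ⟩
  edgeSquares w k ℕ.+ W ℕ.* W                            ∎
  where
  open ≡-Reasoning
  W = 2 ℕ.* k ℕ.+ w

edgeSquares-monoˡ-≤ : ∀ {w w′} k → w ≤ w′ → edgeSquares w k ≤ edgeSquares w′ k
edgeSquares-monoˡ-≤ zero    w≤w′ = z≤n
edgeSquares-monoˡ-≤ (suc k) w≤w′ = ℕ.+-mono-≤ (ℕ.*-mono-≤ w≤w′ w≤w′) (edgeSquares-monoˡ-≤ k (s≤s (s≤s w≤w′)))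

broomMaxJoin : ℕ → ℕ → ℕ
broomMaxJoin b L = b ℕ.+ edgeSquares (2 ℕ.* b ℕ.+ 1) L

handleJoin : ℕ → ℕ → ℕ → ℕ
handleJoin b x m = broomMaxJoin b x ℕ.+ edgeSquares 1 m

bristleJoin : ℕ → ℕ → ℕ
bristleJoin b L = b ℕ.+ V ℕ.* V ℕ.+ edgeSquares 1 L
  where V = 2 ℕ.* L ℕ.+ (2 ℕ.* b ℕ.+ 1)

handleJoin-≤ : ∀ b x m → handleJoin b x m ≤ broomMaxJoin b (x ℕ.+ m)
handleJoin-≤ b x m = begin
  b ℕ.+ edgeSquares w x ℕ.+ edgeSquares 1 m
    ≤⟨ ℕ.+-monoʳ-≤ (b ℕ.+ edgeSquares w x) (edgeSquares-monoˡ-≤ m 1≤) ⟩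
  b ℕ.+ edgeSquares w x ℕ.+ edgeSquares (2 ℕ.* x ℕ.+ w) m       ≡⟨ ℕ.+-assoc b _ _ ⟩
  b ℕ.+ (edgeSquares w x ℕ.+ edgeSquares (2 ℕ.* x ℕ.+ w) m)     ≡⟨ cong (b ℕ.+_) (edgeSquares-+ w x m) ⟨
  b ℕ.+ edgeSquares w (x ℕ.+ m)                                 ∎
  where
  open ℕ.≤-Reasoning
  w = 2 ℕ.* b ℕ.+ 1
  1≤ : 1 ≤ 2 ℕ.* x ℕ.+ w
  1≤ = ℕ.≤-trans (ℕ.m≤n+m 1 (2 ℕ.* b)) (ℕ.m≤n+m w (2 ℕ.* x))

bristleJoin-≤ : ∀ b c → bristleJoin b (suc c) ≤ broomMaxJoin (suc b) (suc c)
bristleJoin-≤ b c = begin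
  b ℕ.+ V ℕ.* V ℕ.+ (1 ℕ.+ edgeSquares 3 c)   ≡⟨ regroup b (V ℕ.* V) (edgeSquares 3 c) ⟩
  suc b ℕ.+ (edgeSquares 3 c ℕ.+ V ℕ.* V)
    ≤⟨ ℕ.+-monoʳ-≤ (suc b) (ℕ.+-monoˡ-≤ (V ℕ.* V) (edgeSquares-monoˡ-≤ c 3≤w)) ⟩
  suc b ℕ.+ (edgeSquares w c ℕ.+ V ℕ.* V)
    ≡⟨ cong (λ V′ → suc b ℕ.+ (edgeSquares w c ℕ.+ V′ ℕ.* V′)) V≡ ⟩
  suc b ℕ.+ (edgeSquares w c ℕ.+ (2 ℕ.* c ℕ.+ w) ℕ.* (2 ℕ.* c ℕ.+ w))
    ≡⟨ cong (suc b ℕ.+_) (edgeSquares-snoc w c) ⟨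
  suc b ℕ.+ edgeSquares w (suc c)             ∎
  where
  open ℕ.≤-Reasoning
  w = 2 ℕ.* suc b ℕ.+ 1
  V = 2 ℕ.* suc c ℕ.+ (2 ℕ.* b ℕ.+ 1)
  3≤w : 3 ≤ w
  3≤w = ℕ.+-monoˡ-≤ 1 (ℕ.*-monoʳ-≤ 2 (s≤s z≤n))
  V≡ : V ≡ 2 ℕ.* c ℕ.+ w
  V≡ = shift c b
    where
    shift : ∀ c b → 2 ℕ.* suc c ℕ.+ (2 ℕ.* b ℕ.+ 1) ≡ 2 ℕ.* c ℕ.+ (2 ℕ.* suc b ℕ.+ 1)
    shift = ℕ-Solver.solve-∀
  regroup : ∀ b s e → b ℕ.+ s ℕ.+ (1 ℕ.+ e) ≡ suc b ℕ.+ (e ℕ.+ s)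
  regroup = ℕ-Solver.solve-∀

broomMaxJoin-step : ∀ b L → broomMaxJoin (suc (suc b)) L < broomMaxJoin (suc b) (suc L)
broomMaxJoin-step b L = begin-strict
  suc (suc b) ℕ.+ edgeSquares (2 ℕ.* suc (suc b) ℕ.+ 1) L ≡⟨ cong (λ w′ → suc (suc b) ℕ.+ edgeSquares w′ L) (shift b) ⟨
  suc (suc b) ℕ.+ X                      ≡⟨ regroupˡ b X ⟩
  suc b ℕ.+ X ℕ.+ 1                      <⟨ ℕ.+-monoʳ-< (suc b ℕ.+ X) 1<w*w ⟩
  suc b ℕ.+ X ℕ.+ w ℕ.* w                ≡⟨ regroupʳ b X (w ℕ.* w) ⟩
  suc b ℕ.+ (w ℕ.* w ℕ.+ X)              ∎
  where
  open ℕ.≤-Reasoning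
  w = 2 ℕ.* suc b ℕ.+ 1
  X = edgeSquares (2 ℕ.+ w) L
  1<w*w : 1 < w ℕ.* w
  1<w*w = ℕ.≤-trans (ℕ.n≤1+n 2) (ℕ.≤-trans (ℕ.+-monoˡ-≤ 1 (ℕ.*-monoʳ-≤ 2 (s≤s z≤n))) (ℕ.m≤m*n w w))
  shift : ∀ b → 2 ℕ.+ (2 ℕ.* suc b ℕ.+ 1) ≡ 2 ℕ.* suc (suc b) ℕ.+ 1
  shift = ℕ-Solver.solve-∀
  regroupˡ : ∀ b X → suc (suc b) ℕ.+ X ≡ suc b ℕ.+ X ℕ.+ 1
  regroupˡ = ℕ-Solver.solve-∀
  regroupʳ : ∀ b X y → suc b ℕ.+ X ℕ.+ y ≡ suc b ℕ.+ (y ℕ.+ X)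
  regroupʳ = ℕ-Solver.solve-∀

broomMaxJoin-∸-step : ∀ {n d} → 1 ≤ d → suc d < n →
                      broomMaxJoin (n ∸ d) (d ∸ 1) < broomMaxJoin (n ∸ suc d) (suc d ∸ 1)
broomMaxJoin-∸-step {d = suc L} (s≤s z≤n) d+1<n with ℕ.m≤n⇒∃[o]m+o≡n d+1<n
... | o , refl = subst₂ (λ p q → broomMaxJoin p L < broomMaxJoin q (suc L))
                        (sym (trans (cong (_∸ suc L) (shift₁ L o)) (ℕ.m+n∸m≡n (suc L) (suc (suc o)))))
                        (sym (trans (cong (_∸ suc (suc L)) (shift₂ L o)) (ℕ.m+n∸m≡n (suc (suc L)) (suc o))))
                        (broomMaxJoin-step o L)
  where
  shift₁ : ∀ L o → suc (suc (suc L)) ℕ.+ o ≡ suc L ℕ.+ suc (suc o)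
  shift₁ = ℕ-Solver.solve-∀
  shift₂ : ∀ L o → suc (suc (suc L)) ℕ.+ o ≡ suc (suc L) ℕ.+ suc o
  shift₂ = ℕ-Solver.solve-∀

broomMaxJoin-∸-strictMono : ∀ {n d d′} → 1 ≤ d → d < d′ → d′ < n →
                            broomMaxJoin (n ∸ d) (d ∸ 1) < broomMaxJoin (n ∸ d′) (d′ ∸ 1)
broomMaxJoin-∸-strictMono {d′ = suc e} 1≤d (s≤s d≤e) e+1<n with ℕ.m≤n⇒m<n∨m≡n d≤e
... | inj₁ d<e  = ℕ.<-trans (broomMaxJoin-∸-strictMono 1≤d d<e (ℕ.<-trans (ℕ.n<1+n e) e+1<n))
                            (broomMaxJoin-∸-step (ℕ.≤-trans 1≤d (ℕ.<⇒≤ d<e)) e+1<n)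
... | inj₂ refl = broomMaxJoin-∸-step 1≤d e+1<n

fromℕ-edgeSquares-snoc : ∀ w k → fromℕ (edgeSquares w (suc k)) ≡
                         fromℕ (edgeSquares w k) + fromℕ (2 ℕ.* k ℕ.+ w) * fromℕ (2 ℕ.* k ℕ.+ w)
fromℕ-edgeSquares-snoc w k = begin
  fromℕ (edgeSquares w (suc k))                                  ≡⟨ cong fromℕ (edgeSquares-snoc w k) ⟩
  fromℕ (edgeSquares w k ℕ.+ W ℕ.* W)                            ≡⟨ fromℕ-+ (edgeSquares w k) (W ℕ.* W) ⟩
  fromℕ (edgeSquares w k) + fromℕ (W ℕ.* W)                      ≡⟨ cong (fromℕ (edgeSquares w k) +_) (fromℕ-* W W) ⟩
  fromℕ (edgeSquares w k) + fromℕ W * fromℕ W                    ∎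
  where
  open ≡-Reasoning
  W = 2 ℕ.* k ℕ.+ w

fromℕ-2*suc+ : ∀ w k → fromℕ (2 ℕ.* suc k ℕ.+ w) ≡ two + fromℕ (2 ℕ.* k ℕ.+ w)
fromℕ-2*suc+ w k = begin
  fromℕ (2 ℕ.* suc k ℕ.+ w)           ≡⟨ cong fromℕ (shift k w) ⟩
  1ℚ + (1ℚ + fromℕ (2 ℕ.* k ℕ.+ w))   ≡⟨ ℚ.+-assoc 1ℚ 1ℚ (fromℕ (2 ℕ.* k ℕ.+ w)) ⟨
  two + fromℕ (2 ℕ.* k ℕ.+ w)         ∎
  where
  open ≡-Reasoning
  shift : ∀ k w → 2 ℕ.* suc k ℕ.+ w ≡ 2 ℕ.+ (2 ℕ.* k ℕ.+ w)
  shift = ℕ-Solver.solve-∀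

-- One edge of a path walked towards the target: a, a′, a″ are consecutive values of H(·, v),
-- W is the total degree of the vertices behind a′ and S = W a + E their degree-weighted sum.
sweep-step : ∀ {a a′ a″ W S E} → a ≡ a′ + W → two * a′ ≡ two + (a + a″) → S ≡ W * a + E →
             a′ ≡ a″ + (two + W) × S + two * a′ ≡ (two + W) * a′ + (E + W * W)
sweep-step {a} {a′} {a″} {W} {S} {E} a≡a′+W balance S≡ = a′≡ , S′≡
  where
  open ≡-Reasoning
  a′≡ : a′ ≡ a″ + (two + W)
  a′≡ = begin
    a′                              ≡⟨ solve (a′ ∷ []) ℚ-ring ⟩
    two * a′ - a′                   ≡⟨ cong (_- a′) balance ⟩
    two + (a + a″) - a′             ≡⟨ cong (λ z → two + (z + a″) - a′) a≡a′+W ⟩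
    two + (a′ + W + a″) - a′        ≡⟨ solve (a′ ∷ a″ ∷ W ∷ []) ℚ-ring ⟩
    a″ + (two + W)                  ∎
  S′≡ : S + two * a′ ≡ (two + W) * a′ + (E + W * W)
  S′≡ = begin
    S + two * a′                    ≡⟨ cong (_+ two * a′) S≡ ⟩
    W * a + E + two * a′            ≡⟨ cong (λ z → W * z + E + two * a′) a≡a′+W ⟩
    W * (a′ + W) + E + two * a′     ≡⟨ solve (a′ ∷ W ∷ E ∷ []) ℚ-ring ⟩
    (two + W) * a′ + (E + W * W)    ∎

sweep-up : ∀ (f : ℕ → ℚ) w k → f 0 ≡ f 1 + fromℕ w →
            (∀ {j} → j < k → two * f (suc j) ≡ two + (f j + f (suc (suc j)))) →
            f k ≡ f (suc k) + fromℕ (2 ℕ.* k ℕ.+ w) ×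
            fromℕ w * f 0 + two * sumFrom 1 k f ≡ fromℕ (2 ℕ.* k ℕ.+ w) * f k + fromℕ (edgeSquares w k)
sweep-up f w zero    start balanced = start , cong (fromℕ w * f 0 +_) (ℚ.*-zeroʳ two)
sweep-up f w (suc k) start balanced =
  let f[k]≡ , S[k]≡   = sweep-up f w k start (balanced ∘ ℕ.m<n⇒m<1+n)
      f[k+1]≡ , S≡    = sweep-step f[k]≡ (balanced (ℕ.n<1+n k)) S[k]≡
  in trans f[k+1]≡ (cong (f (suc (suc k)) +_) (sym (fromℕ-2*suc+ w k))) , (begin
    fromℕ w * f 0 + two * sumFrom 1 (suc k) f         ≡⟨ cong (λ s → fromℕ w * f 0 + two * s) (sumFrom-snoc 1 k f) ⟩
    fromℕ w * f 0 + two * (sumFrom 1 k f + f (suc k)) ≡⟨ regroup (fromℕ w * f 0) (sumFrom 1 k f) (f (suc k)) ⟩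
    fromℕ w * f 0 + two * sumFrom 1 k f + two * f (suc k) ≡⟨ S≡ ⟩
    (two + W) * f (suc k) + (fromℕ (edgeSquares w k) + W * W)
      ≡⟨ cong₂ (λ W′ E′ → W′ * f (suc k) + E′) (fromℕ-2*suc+ w k) (fromℕ-edgeSquares-snoc w k) ⟨
    fromℕ (2 ℕ.* suc k ℕ.+ w) * f (suc k) + fromℕ (edgeSquares w (suc k)) ∎)
  where
  open ≡-Reasoning
  W = fromℕ (2 ℕ.* k ℕ.+ w)
  regroup : ∀ x y z → x + two * (y + z) ≡ x + two * y + two * z
  regroup = solve-∀ ℚ-ring

sweep-down : ∀ (g : ℕ → ℚ) {t} → g (suc t) ≡ 1ℚ + g t → ∀ m q → q ℕ.+ m ≡ t →
           (∀ {i} → q ≤ i → i < t → two * g (suc i) ≡ two + (g i + g (suc (suc i)))) →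
           g (suc q) ≡ g q + fromℕ (2 ℕ.* m ℕ.+ 1) ×
           g (suc t) + two * sumFrom (suc q) m g ≡ fromℕ (2 ℕ.* m ℕ.+ 1) * g (suc q) + fromℕ (edgeSquares 1 m)
sweep-down g tip zero q q+0≡t balanced with trans (sym (ℕ.+-identityʳ q)) q+0≡t
... | refl = trans tip (ℚ.+-comm 1ℚ (g q)) , base (g (suc q))
  where
  base : ∀ x → x + two * 0ℚ ≡ 1ℚ * x + 0ℚ
  base = solve-∀ ℚ-ring
sweep-down g {t} tip (suc m) q q+m+1≡t balanced =
  let g[q+2]≡ , T[q+2]≡ = sweep-down g tip m (suc q) (trans (sym (ℕ.+-suc q m)) q+m+1≡t) (balanced ∘ ℕ.<⇒≤)
      g[q+1]≡ , T≡      = sweep-step g[q+2]≡ (trans (balanced ℕ.≤-refl q<t) (cong (two +_) (ℚ.+-comm (g q) _))) T[q+2]≡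
  in trans g[q+1]≡ (cong (g q +_) (sym (fromℕ-2*suc+ 1 m))) , (begin
    g (suc t) + two * (g (suc q) + sumFrom (suc (suc q)) m g)     ≡⟨ regroup (g (suc t)) (g (suc q)) _ ⟩
    g (suc t) + two * sumFrom (suc (suc q)) m g + two * g (suc q) ≡⟨ T≡ ⟩
    (two + W) * g (suc q) + (fromℕ (edgeSquares 1 m) + W * W)
      ≡⟨ cong₂ (λ W′ E′ → W′ * g (suc q) + E′) (fromℕ-2*suc+ 1 m) (fromℕ-edgeSquares-snoc 1 m) ⟨
    fromℕ (2 ℕ.* suc m ℕ.+ 1) * g (suc q) + fromℕ (edgeSquares 1 (suc m)) ∎)
  where
  open ≡-Reasoning
  W = fromℕ (2 ℕ.* m ℕ.+ 1)
  q<t : q < t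
  q<t = subst (q <_) q+m+1≡t (ℕ.m<m+n q (s≤s z≤n))
  regroup : ∀ x y z → x + two * (y + z) ≡ x + two * z + two * y
  regroup = solve-∀ ℚ-ring

data BroomEdge (d : ℕ) : ℕ → ℕ → Set where
  handle    : ∀ {i} → suc i < d → BroomEdge d i (suc i)
  handle⁻¹  : ∀ {i} → suc i < d → BroomEdge d (suc i) i
  bristle   : ∀ {j} → d ≤ j → BroomEdge d 0 j
  bristle⁻¹ : ∀ {j} → d ≤ j → BroomEdge d j 0

private
  T-∨⁻ : ∀ x {y} → T (x ∨ y) → T x ⊎ T y
  T-∨⁻ true  t = inj₁ t
  T-∨⁻ false t = inj₂ t

  T-∧⁻ : ∀ x {y} → T (x ∧ y) → T x × T y
  T-∧⁻ true t = _ , t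

  T-∨⁺ˡ : ∀ {x} y → T x → T (x ∨ y)
  T-∨⁺ˡ {true} y t = t

  T-∨⁺ʳ : ∀ x {y} → T y → T (x ∨ y)
  T-∨⁺ʳ true  t = _
  T-∨⁺ʳ false t = t

  T-∧⁺ : ∀ {x y} → T x → T y → T (x ∧ y)
  T-∧⁺ {true} _ t = t

broomAdjℕ-sound : ∀ d i j → T (broomAdjℕ d i j) → BroomEdge d i j
broomAdjℕ-sound d i j adj with T-∨⁻ ((i <ᵇ d) ∧ (j <ᵇ d) ∧ ((suc i ≡ᵇ j) ∨ (suc j ≡ᵇ i))) adj
... | inj₁ on-handle with T-∧⁻ (i <ᵇ d) on-handle
...   | i<d , on-handle′ with T-∧⁻ (j <ᵇ d) on-handle′
...     | j<d , consecutive with T-∨⁻ (suc i ≡ᵇ j) consecutive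
...       | inj₁ i+1≡j with ℕ.≡ᵇ⇒≡ (suc i) j i+1≡j
...         | refl = handle (ℕ.<ᵇ⇒< j d j<d)
broomAdjℕ-sound d i j adj | inj₁ _ | i<d , _ | _ | inj₂ j+1≡i with ℕ.≡ᵇ⇒≡ (suc j) i j+1≡i
...         | refl = handle⁻¹ (ℕ.<ᵇ⇒< i d i<d)
broomAdjℕ-sound d i j adj | inj₂ at-hub with T-∨⁻ ((i ≡ᵇ 0) ∧ (d ℕ.≤ᵇ j)) at-hub
... | inj₁ hub-first with T-∧⁻ (i ≡ᵇ 0) hub-first
...   | i≡0 , d≤j with ℕ.≡ᵇ⇒≡ i 0 i≡0
...     | refl = bristle (ℕ.≤ᵇ⇒≤ d j d≤j)
broomAdjℕ-sound d i j adj | inj₂ _ | inj₂ hub-second with T-∧⁻ (j ≡ᵇ 0) hub-second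
...   | j≡0 , d≤i with ℕ.≡ᵇ⇒≡ j 0 j≡0
...     | refl = bristle⁻¹ (ℕ.≤ᵇ⇒≤ d i d≤i)

broomAdjℕ-complete : ∀ {d i j} → BroomEdge d i j → T (broomAdjℕ d i j)
broomAdjℕ-complete {d} (handle {i} i+1<d) =
  T-∨⁺ˡ _ (T-∧⁺ (ℕ.<⇒<ᵇ (ℕ.<-trans (ℕ.n<1+n i) i+1<d)) (T-∧⁺ (ℕ.<⇒<ᵇ i+1<d)
    (T-∨⁺ˡ _ (ℕ.≡⇒≡ᵇ (suc i) (suc i) refl))))
broomAdjℕ-complete {d} (handle⁻¹ {i} i+1<d) =
  T-∨⁺ˡ _ (T-∧⁺ (ℕ.<⇒<ᵇ i+1<d) (T-∧⁺ (ℕ.<⇒<ᵇ (ℕ.<-trans (ℕ.n<1+n i) i+1<d))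
    (T-∨⁺ʳ (suc (suc i) ≡ᵇ i) (ℕ.≡⇒≡ᵇ (suc i) (suc i) refl))))
broomAdjℕ-complete {d} {j = j} (bristle d≤j) =
  T-∨⁺ʳ ((0 <ᵇ d) ∧ (j <ᵇ d) ∧ ((1 ≡ᵇ j) ∨ (suc j ≡ᵇ 0))) (T-∨⁺ˡ _ (T-∧⁺ {true} _ (ℕ.≤⇒≤ᵇ d≤j)))
broomAdjℕ-complete {d} {i} (bristle⁻¹ d≤i) =
  T-∨⁺ʳ ((i <ᵇ d) ∧ (0 <ᵇ d) ∧ ((suc i ≡ᵇ 0) ∨ (1 ≡ᵇ i)))
        (T-∨⁺ʳ ((i ≡ᵇ 0) ∧ (d ℕ.≤ᵇ 0)) (T-∧⁺ {true} _ (ℕ.≤⇒≤ᵇ d≤i)))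

indicator-edge : ∀ {d i j} → BroomEdge d i j → ∀ a → indicator (broomAdjℕ d i j) * a ≡ a
indicator-edge {d} {i} {j} e a with broomAdjℕ d i j | broomAdjℕ-complete e
... | true | _ = ℚ.*-identityˡ a

indicator-non-edge : ∀ {d i j} → ¬ BroomEdge d i j → ∀ a → indicator (broomAdjℕ d i j) * a ≡ 0ℚ
indicator-non-edge {d} {i} {j} ¬e a with broomAdjℕ d i j | broomAdjℕ-sound d i j
... | false | _     = ℚ.*-zeroˡ a
... | true  | sound = ⊥-elim (¬e (sound _))

module _ {c : ℕ} where

  neighbours-of-hub : ∀ {j} → BroomEdge (suc (suc c)) 0 j → j < suc (suc c) → j ≡ 1
  neighbours-of-hub (handle _)        _   = refl
  neighbours-of-hub (bristle d≤j)     j<d = ⊥-elim (ℕ.<⇒≱ j<d d≤j)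

  neighbours-of-inner : ∀ {i j} → i < c → BroomEdge (suc (suc c)) (suc i) j → j ≡ i ⊎ j ≡ suc (suc i)
  neighbours-of-inner i<c (handle _)        = inj₂ refl
  neighbours-of-inner i<c (handle⁻¹ _)      = inj₁ refl
  neighbours-of-inner i<c (bristle⁻¹ d≤i+1) = ⊥-elim (ℕ.<⇒≱ (s≤s (ℕ.m<n⇒m<1+n i<c)) d≤i+1)

  neighbours-of-tip : ∀ {j} → BroomEdge (suc (suc c)) (suc c) j → j ≡ c
  neighbours-of-tip (handle d<d)      = ⊥-elim (ℕ.<-irrefl refl d<d)
  neighbours-of-tip (handle⁻¹ _)      = refl
  neighbours-of-tip (bristle⁻¹ d≤c+1) = ⊥-elim (ℕ.<⇒≱ (ℕ.n<1+n _) d≤c+1)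

  neighbours-of-bristle : ∀ {k j} → suc (suc c) ≤ k → BroomEdge (suc (suc c)) k j → j ≡ 0
  neighbours-of-bristle d≤k (handle k+1<d)   = ⊥-elim (ℕ.<⇒≱ (ℕ.<-trans (ℕ.n<1+n _) k+1<d) d≤k)
  neighbours-of-bristle d≤k (handle⁻¹ k<d)   = ⊥-elim (ℕ.<⇒≱ k<d d≤k)
  neighbours-of-bristle () (bristle _)
  neighbours-of-bristle d≤k (bristle⁻¹ _)    = refl

-- The broom with d = c + 2 and n = d + b: hub 0, handle tip c + 1, bristles c + 2, …, c + b + 1.
handle<n : ∀ {c b j} → j ≤ suc c → j < suc (suc c) ℕ.+ b
handle<n {c} {b} j≤c+1 = ℕ.≤-trans (s≤s j≤c+1) (ℕ.m≤m+n (suc (suc c)) b)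

neighbourSum : ℕ → ℕ → ℕ → (ℕ → ℚ) → ℚ
neighbourSum c b k G = sumFrom 0 (suc (suc c) ℕ.+ b) (λ j → indicator (broomAdjℕ (suc (suc c)) k j) * G j)

module _ (c b : ℕ) (G : ℕ → ℚ) where

  private
    d = suc (suc c)
    n = d ℕ.+ b

    handle-inRange : ∀ {j} → j ≤ suc c → InRange 0 n j
    handle-inRange j≤c+1 = z≤n , handle<n j≤c+1

    term : ℕ → ℕ → ℚ
    term k j = indicator (broomAdjℕ d k j) * G j

  neighbourSum-hub : neighbourSum c b 0 G ≡ G 1 + sumFrom d b G
  neighbourSum-hub = begin
    sumFrom 0 (d ℕ.+ b) (term 0)          ≡⟨ sumFrom-++ 0 d b (term 0) ⟩
    sumFrom 0 d (term 0) + sumFrom d b (term 0)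
      ≡⟨ cong₂ _+_ (sumFrom-support₁ (term 0) (z≤n , s≤s (s≤s z≤n)) λ j∈ j≢1 →
                      indicator-non-edge (j≢1 ∘ λ e → neighbours-of-hub e (proj₂ j∈)) _)
                   (sumFrom-cong {d} {b} {term 0} {G} λ j∈ → indicator-edge (bristle (proj₁ j∈)) _) ⟩
    term 0 1 + sumFrom d b G              ≡⟨ cong (_+ sumFrom d b G) (indicator-edge {d} {0} {1} (handle (s≤s (s≤s z≤n))) (G 1)) ⟩
    G 1 + sumFrom d b G                   ∎
    where open ≡-Reasoning

  neighbourSum-inner : ∀ {i} → i < c → neighbourSum c b (suc i) G ≡ G i + G (suc (suc i))
  neighbourSum-inner {i} i<c = begin
    sumFrom 0 n (term (suc i))
      ≡⟨ sumFrom-support₂ (term (suc i)) (ℕ.m<n⇒m<1+n (ℕ.n<1+n i))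
           (handle-inRange (ℕ.m≤n⇒m≤1+n (ℕ.<⇒≤ i<c))) (handle-inRange (s≤s i<c))
           (λ _ j≢i j≢i+2 → indicator-non-edge ([ j≢i , j≢i+2 ]′ ∘ neighbours-of-inner i<c) _) ⟩
    term (suc i) i + term (suc i) (suc (suc i))
      ≡⟨ cong₂ _+_ (indicator-edge (handle⁻¹ (s≤s (ℕ.m<n⇒m<1+n i<c))) (G i))
                   (indicator-edge (handle (s≤s (s≤s i<c))) (G (suc (suc i)))) ⟩
    G i + G (suc (suc i)) ∎
    where open ≡-Reasoning

  neighbourSum-tip : neighbourSum c b (suc c) G ≡ G c
  neighbourSum-tip =
    trans (sumFrom-support₁ (term (suc c)) (handle-inRange (ℕ.n≤1+n c))
            λ _ j≢c → indicator-non-edge (j≢c ∘ neighbours-of-tip) _)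
          (indicator-edge (handle⁻¹ (ℕ.n<1+n (suc c))) (G c))

  neighbourSum-bristle : ∀ {k} → d ≤ k → neighbourSum c b k G ≡ G 0
  neighbourSum-bristle {k} d≤k =
    trans (sumFrom-support₁ (term k) (handle-inRange z≤n)
            λ _ j≢0 → indicator-non-edge (j≢0 ∘ neighbours-of-bristle d≤k) _)
          (indicator-edge (bristle⁻¹ d≤k) (G 0))

record BroomFirstStep (c b x : ℕ) (g : ℕ → ℚ) : Set where
  field
    at-target  : g x ≡ 0ℚ
    at-hub     : x ≢ 0 → fromℕ (suc b) * g 0 ≡ fromℕ (suc b) + (g 1 + sumFrom (suc (suc c)) b g)
    at-inner   : ∀ {i} → i < c → x ≢ suc i → two * g (suc i) ≡ two + (g i + g (suc (suc i)))
    at-tip     : x ≢ suc c → g (suc c) ≡ 1ℚ + g c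
    at-bristle : ∀ {j} → InRange (suc (suc c)) b j → x ≢ j → g j ≡ 1ℚ + g 0

joinSum : ℕ → ℕ → (ℕ → ℚ) → ℚ
joinSum c b g = fromℕ (suc b) * g 0 + sumFrom (suc (suc c)) b g + (two * sumFrom 1 c g + g (suc c))

module _ {c b : ℕ} {h : Fin (suc (suc c) ℕ.+ b) → Fin (suc (suc c) ℕ.+ b) → ℚ}
         (hitting : IsHittingTime (suc (suc c) ℕ.+ b) (suc (suc c)) h) (v : Fin (suc (suc c) ℕ.+ b)) where

  private
    d = suc (suc c)
    n = d ℕ.+ b
    x = toℕ v
    g = extend (λ u → h u v)

    degree : ℕ → ℚ
    degree k = neighbourSum c b k (λ _ → 1ℚ)

    deg≡degree : ∀ u → deg n d u ≡ degree (toℕ u)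
    deg≡degree u = Σᵥ-sumFrom n (λ w → indicator (adj n d u w)) (λ j → indicator (broomAdjℕ d (toℕ u) j) * 1ℚ)
                   λ w → sym (ℚ.*-identityʳ (indicator (adj n d u w)))

    first-step : ∀ {k δ S} → k < n → x ≢ k → degree k ≡ δ → neighbourSum c b k g ≡ S → δ * g k ≡ δ + S
    first-step {k} {δ} {S} k<n x≢k degree≡δ nbrs≡S = begin
      δ * g k                                   ≡⟨ cong₂ _*_ (sym degree≡δ) (extend-fromℕ< _ k<n) ⟩
      degree k * h u v                          ≡⟨ cong (_* h u v) (cong degree (sym (Fin.toℕ-fromℕ< k<n))) ⟩
      degree (toℕ u) * h u v                    ≡⟨ cong (_* h u v) (deg≡degree u) ⟨
      deg n d u * h u v
        ≡⟨ proj₂ hitting u v (λ u≡v → x≢k (trans (cong toℕ (sym u≡v)) (Fin.toℕ-fromℕ< k<n))) ⟩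
      deg n d u + Σᵥ n (λ w → indicator (adj n d u w) * h w v)
        ≡⟨ cong₂ _+_ (trans (deg≡degree u) (cong degree (Fin.toℕ-fromℕ< k<n)))
                     (Σᵥ-sumFrom n _ (λ j → indicator (broomAdjℕ d k j) * g j) λ w →
                        cong₂ (λ k′ y → indicator (broomAdjℕ d k′ (toℕ w)) * y) (Fin.toℕ-fromℕ< k<n) (sym (extend-toℕ _ w))) ⟩
      degree k + neighbourSum c b k g           ≡⟨ cong₂ _+_ degree≡δ nbrs≡S ⟩
      δ + S                                     ∎
      where
      open ≡-Reasoning
      u = fromℕ< k<n

    degree-hub : degree 0 ≡ fromℕ (suc b)
    degree-hub = trans (neighbourSum-hub c b (λ _ → 1ℚ))
                       (cong (1ℚ +_) (trans (sumFrom-const d b 1ℚ) (ℚ.*-identityʳ (fromℕ b))))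

    1*-cancel : ∀ {p q} → 1ℚ * p ≡ q → p ≡ q
    1*-cancel = trans (sym (ℚ.*-identityˡ _))

  broomFirstStep : BroomFirstStep c b x g
  broomFirstStep = record
    { at-target  = trans (extend-toℕ _ v) (proj₁ hitting v)
    ; at-hub     = λ x≢0 → first-step (s≤s z≤n) x≢0 degree-hub (neighbourSum-hub c b g)
    ; at-inner   = λ i<c x≢i+1 → first-step (handle<n (s≤s (ℕ.<⇒≤ i<c))) x≢i+1
                     (neighbourSum-inner c b (λ _ → 1ℚ) i<c) (neighbourSum-inner c b g i<c)
    ; at-tip     = λ x≢c+1 → 1*-cancel (first-step (handle<n ℕ.≤-refl) x≢c+1
                     (neighbourSum-tip c b (λ _ → 1ℚ)) (neighbourSum-tip c b g))
    ; at-bristle = λ j∈ x≢j → 1*-cancel (first-step (proj₂ j∈) x≢j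
                     (neighbourSum-bristle c b (λ _ → 1ℚ) (proj₁ j∈)) (neighbourSum-bristle c b g (proj₁ j∈)))
    }

  J≡joinSum : J n d h v ≡ joinSum c b g
  J≡joinSum = begin
    J n d h v                                  ≡⟨ Σᵥ-sumFrom n _ W (λ u → cong₂ _*_ (deg≡degree u) (sym (extend-toℕ _ u))) ⟩
    W 0 + sumFrom 1 (suc c ℕ.+ b) W            ≡⟨ cong (λ m → W 0 + sumFrom 1 m W) (ℕ.+-suc c b) ⟨
    W 0 + sumFrom 1 (c ℕ.+ suc b) W            ≡⟨ cong (W 0 +_) (sumFrom-++ 1 c (suc b) W) ⟩
    W 0 + (sumFrom 1 c W + (W (suc c) + sumFrom d b W))
      ≡⟨ cong₂ _+_ (cong (_* g 0) degree-hub)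
               (cong₂ _+_ (trans (sumFrom-cong {F = W} inner-term) (sumFrom-*ˡ 1 c two g))
                          (cong₂ _+_ (trans (cong (_* g (suc c)) (neighbourSum-tip c b (λ _ → 1ℚ))) (ℚ.*-identityˡ (g (suc c))))
                                     (sumFrom-cong {d} {b} {W} {g} bristle-term))) ⟩
    fromℕ (suc b) * g 0 + (two * sumFrom 1 c g + (g (suc c) + sumFrom d b g))
      ≡⟨ regroup (fromℕ (suc b) * g 0) (two * sumFrom 1 c g) (g (suc c)) (sumFrom d b g) ⟩
    joinSum c b g                              ∎
    where
    open ≡-Reasoning
    W : ℕ → ℚ
    W k = degree k * g k
    inner-term : ∀ {j} → InRange 1 c j → W j ≡ two * g j
    inner-term {suc i} (_ , s≤s i<c) = cong (_* g (suc i)) (neighbourSum-inner c b (λ _ → 1ℚ) i<c)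
    bristle-term : ∀ {j} → InRange d b j → W j ≡ g j
    bristle-term {j} j∈ = trans (cong (_* g j) (neighbourSum-bristle c b (λ _ → 1ℚ) (proj₁ j∈))) (ℚ.*-identityˡ (g j))
    regroup : ∀ p s t q → p + (s + (t + q)) ≡ p + q + (s + t)
    regroup = solve-∀ ℚ-ring

hub-balance : ∀ {B y z} → (1ℚ + B) * y ≡ (1ℚ + B) + (z + B * (1ℚ + y)) → y ≡ z + (two * B + 1ℚ)
hub-balance {B} {y} {z} balance = begin
  y                                        ≡⟨ solve (y ∷ B ∷ []) ℚ-ring ⟩
  (1ℚ + B) * y - B * y                     ≡⟨ cong (_- B * y) balance ⟩
  (1ℚ + B) + (z + B * (1ℚ + y)) - B * y    ≡⟨ solve (y ∷ z ∷ B ∷ []) ℚ-ring ⟩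
  z + (two * B + 1ℚ)                       ∎
  where open ≡-Reasoning

module HandleTarget {c b x : ℕ} {g : ℕ → ℚ} (fs : BroomFirstStep c b x g) where
  open BroomFirstStep fs

  private
    B = fromℕ b
    w = 2 ℕ.* b ℕ.+ 1

  bristles-off-target : x ≤ suc c → sumFrom (suc (suc c)) b g ≡ B * (1ℚ + g 0)
  bristles-off-target x≤c+1 =
    trans (sumFrom-cong λ j∈ → at-bristle j∈ (ℕ.<⇒≢ (ℕ.<-≤-trans (s≤s x≤c+1) (proj₁ j∈))))
          (sumFrom-const (suc (suc c)) b (1ℚ + g 0))

  hub-start : ∀ {i} → x ≡ suc i → i ≤ c → g 0 ≡ g 1 + fromℕ w
  hub-start x≡i+1 i≤c = trans (hub-balance {B} {g 0} {g 1} (trans (at-hub λ x≡0 → ℕ.0≢1+n (trans (sym x≡0) x≡i+1))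
                                                 (cong (λ s → (1ℚ + B) + (g 1 + s)) (bristles-off-target x≤c+1))))
                              (cong (g 1 +_) (sym (fromℕ-2*+ b 1)))
    where
    x≤c+1 : x ≤ suc c
    x≤c+1 = subst (_≤ suc c) (sym x≡i+1) (s≤s i≤c)

  hub-branch : ∀ {i} → x ≡ suc i → i ≤ c →
              fromℕ (suc b) * g 0 + sumFrom (suc (suc c)) b g + two * sumFrom 1 i g ≡ fromℕ (broomMaxJoin b (suc i))
  hub-branch {i} x≡i+1 i≤c = begin
    fromℕ (suc b) * g 0 + sumFrom (suc (suc c)) b g + two * sumFrom 1 i g
      ≡⟨ cong (λ s → (1ℚ + B) * g 0 + s + two * sumFrom 1 i g) (bristles-off-target x≤c+1) ⟩
    (1ℚ + B) * g 0 + B * (1ℚ + g 0) + two * sumFrom 1 i g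
      ≡⟨ regroup B (g 0) (two * sumFrom 1 i g) ⟩
    B + ((two * B + 1ℚ) * g 0 + two * sumFrom 1 i g)
      ≡⟨ cong (λ W → B + (W * g 0 + two * sumFrom 1 i g)) (fromℕ-2*+ b 1) ⟨
    B + (fromℕ w * g 0 + two * sumFrom 1 i g)       ≡⟨ cong (B +_) (proj₂ sweep) ⟩
    B + (W * g i + E)                               ≡⟨ cong (λ z → B + (W * z + E)) g[i]≡W ⟩
    B + (W * W + E)                                 ≡⟨ cong (B +_) (trans (ℚ.+-comm (W * W) E) (sym (fromℕ-edgeSquares-snoc w i))) ⟩
    B + fromℕ (edgeSquares w (suc i))               ≡⟨ fromℕ-+ b _ ⟨
    fromℕ (broomMaxJoin b (suc i))             ∎
    where
    open ≡-Reasoning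
    W = fromℕ (2 ℕ.* i ℕ.+ w)
    E = fromℕ (edgeSquares w i)
    x≤c+1 : x ≤ suc c
    x≤c+1 = subst (_≤ suc c) (sym x≡i+1) (s≤s i≤c)
    balanced : ∀ {j} → j < i → two * g (suc j) ≡ two + (g j + g (suc (suc j)))
    balanced j<i = at-inner (ℕ.<-≤-trans j<i i≤c) λ x≡j+1 → ℕ.<-irrefl (trans (sym x≡j+1) x≡i+1) (s≤s j<i)
    sweep : g i ≡ g (suc i) + W × fromℕ w * g 0 + two * sumFrom 1 i g ≡ W * g i + E
    sweep = sweep-up g w i (hub-start x≡i+1 i≤c) balanced
    g[i]≡W : g i ≡ W
    g[i]≡W = trans (proj₁ sweep) (trans (cong (_+ W) (subst (λ y → g y ≡ 0ℚ) x≡i+1 at-target)) (ℚ.+-identityˡ W))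
    regroup : ∀ B g0 s → (1ℚ + B) * g0 + B * (1ℚ + g0) + s ≡ B + ((two * B + 1ℚ) * g0 + s)
    regroup = solve-∀ ℚ-ring

  tip-branch : ∀ {m} → x ℕ.+ m ≡ c → g (suc c) + two * sumFrom (suc x) m g ≡ fromℕ (edgeSquares 1 (suc m))
  tip-branch {m} x+m≡c = begin
    g (suc c) + two * sumFrom (suc x) m g       ≡⟨ proj₂ sweep ⟩
    W * g (suc x) + E                           ≡⟨ cong (λ z → W * z + E) (trans (proj₁ sweep) (cong (_+ W) at-target)) ⟩
    W * (0ℚ + W) + E                            ≡⟨ close W E ⟩
    E + W * W                                   ≡⟨ fromℕ-edgeSquares-snoc 1 m ⟨
    fromℕ (edgeSquares 1 (suc m))               ∎
    where
    open ≡-Reasoning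
    W = fromℕ (2 ℕ.* m ℕ.+ 1)
    E = fromℕ (edgeSquares 1 m)
    x≤c : x ≤ c
    x≤c = subst (x ≤_) x+m≡c (ℕ.m≤m+n x m)
    balanced : ∀ {i} → x ≤ i → i < c → two * g (suc i) ≡ two + (g i + g (suc (suc i)))
    balanced x≤i i<c = at-inner i<c λ x≡i+1 → ℕ.<-irrefl x≡i+1 (s≤s x≤i)
    sweep : g (suc x) ≡ g x + W × g (suc c) + two * sumFrom (suc x) m g ≡ W * g (suc x) + E
    sweep = sweep-down g (at-tip λ x≡c+1 → ℕ.<-irrefl x≡c+1 (s≤s x≤c)) m x x+m≡c balanced
    close : ∀ W E → W * (0ℚ + W) + E ≡ E + W * W
    close = solve-∀ ℚ-ring

joinSum-on-handle : ∀ {c b g} x {m} → BroomFirstStep c b x g → x ℕ.+ m ≡ suc c →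
                    joinSum c b g ≡ fromℕ (handleJoin b x m)
joinSum-on-handle {c} {b} {g} zero fs refl = begin
  (1ℚ + B) * g 0 + sumFrom (suc (suc c)) b g + (two * sumFrom 1 c g + g (suc c))
    ≡⟨ cong (λ s → (1ℚ + B) * g 0 + s + (two * sumFrom 1 c g + g (suc c))) (bristles-off-target z≤n) ⟩
  (1ℚ + B) * g 0 + B * (1ℚ + g 0) + (two * sumFrom 1 c g + g (suc c))
    ≡⟨ cong (λ z → (1ℚ + B) * z + B * (1ℚ + z) + (two * sumFrom 1 c g + g (suc c))) at-target ⟩
  (1ℚ + B) * 0ℚ + B * (1ℚ + 0ℚ) + (two * sumFrom 1 c g + g (suc c))
    ≡⟨ regroup B (two * sumFrom 1 c g) (g (suc c)) ⟩
  B + (g (suc c) + two * sumFrom 1 c g)    ≡⟨ cong₂ _+_ (cong fromℕ (ℕ.+-identityʳ b)) (sym (tip-branch refl)) ⟨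
  fromℕ (b ℕ.+ 0) + fromℕ (edgeSquares 1 (suc c)) ≡⟨ fromℕ-+ (b ℕ.+ 0) _ ⟨
  fromℕ (handleJoin b 0 (suc c))           ∎
  where
  open ≡-Reasoning
  open BroomFirstStep fs
  open HandleTarget fs
  B = fromℕ b
  regroup : ∀ B s t → (1ℚ + B) * 0ℚ + B * (1ℚ + 0ℚ) + (s + t) ≡ B + (t + s)
  regroup = solve-∀ ℚ-ring
joinSum-on-handle {c} {b} {g} (suc i) {zero} fs x+0≡c+1
  with ℕ.suc-injective (trans (sym (ℕ.+-identityʳ (suc i))) x+0≡c+1)
... | refl = begin
  fromℕ (suc b) * g 0 + sumFrom (suc (suc i)) b g + (two * sumFrom 1 i g + g (suc i))
    ≡⟨ ℚ.+-assoc (fromℕ (suc b) * g 0 + sumFrom (suc (suc i)) b g) _ _ ⟨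
  fromℕ (suc b) * g 0 + sumFrom (suc (suc i)) b g + two * sumFrom 1 i g + g (suc i)
    ≡⟨ cong₂ _+_ (hub-branch refl ℕ.≤-refl) at-target ⟩
  fromℕ (broomMaxJoin b (suc i)) + 0ℚ
    ≡⟨ ℚ.+-identityʳ _ ⟩
  fromℕ (broomMaxJoin b (suc i))
    ≡⟨ cong fromℕ (ℕ.+-identityʳ (broomMaxJoin b (suc i))) ⟨
  fromℕ (handleJoin b (suc i) 0) ∎
  where
  open ≡-Reasoning
  open BroomFirstStep fs
  open HandleTarget fs
joinSum-on-handle {c} {b} {g} (suc i) {suc m} fs x+m≡c+1 = begin
  P + (two * sumFrom 1 c g + g (suc c))
    ≡⟨ cong (λ k → P + (two * sumFrom 1 k g + g (suc c))) (sym i+m+1≡c) ⟩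
  P + (two * sumFrom 1 (i ℕ.+ suc m) g + g (suc c))
    ≡⟨ cong (λ s → P + (two * s + g (suc c))) (sumFrom-++ 1 i (suc m) g) ⟩
  P + (two * (sumFrom 1 i g + (g (suc i) + sumFrom (suc (suc i)) m g)) + g (suc c))
    ≡⟨ cong (λ y → P + (two * (sumFrom 1 i g + (y + sumFrom (suc (suc i)) m g)) + g (suc c))) at-target ⟩
  P + (two * (sumFrom 1 i g + (0ℚ + sumFrom (suc (suc i)) m g)) + g (suc c))
    ≡⟨ regroup P (sumFrom 1 i g) (sumFrom (suc (suc i)) m g) (g (suc c)) ⟩
  (P + two * sumFrom 1 i g) + (g (suc c) + two * sumFrom (suc (suc i)) m g)
    ≡⟨ cong₂ _+_ (hub-branch refl i≤c) (tip-branch (trans (sym (ℕ.+-suc i m)) i+m+1≡c)) ⟩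
  fromℕ (broomMaxJoin b (suc i)) + fromℕ (edgeSquares 1 (suc m))
    ≡⟨ fromℕ-+ (broomMaxJoin b (suc i)) _ ⟨
  fromℕ (handleJoin b (suc i) (suc m)) ∎
  where
  open ≡-Reasoning
  open BroomFirstStep fs
  open HandleTarget fs
  P = fromℕ (suc b) * g 0 + sumFrom (suc (suc c)) b g
  i+m+1≡c : i ℕ.+ suc m ≡ c
  i+m+1≡c = ℕ.suc-injective x+m≡c+1
  i≤c : i ≤ c
  i≤c = subst (i ≤_) i+m+1≡c (ℕ.m≤m+n i (suc m))
  regroup : ∀ p s t e → p + (two * (s + (0ℚ + t)) + e) ≡ (p + two * s) + (e + two * t)
  regroup = solve-∀ ℚ-ring

bristle-balance : ∀ {B y z W} → y ≡ z + W → (1ℚ + (1ℚ + B)) * z ≡ (1ℚ + (1ℚ + B)) + (y + B * (1ℚ + z)) →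
                  z ≡ two + two * B + W
bristle-balance {B} {y} {z} {W} y≡z+W balance = begin
  z                                                        ≡⟨ solve (z ∷ B ∷ []) ℚ-ring ⟩
  (1ℚ + (1ℚ + B)) * z - (1ℚ + B) * z                       ≡⟨ cong (_- (1ℚ + B) * z) balance ⟩
  (1ℚ + (1ℚ + B)) + (y + B * (1ℚ + z)) - (1ℚ + B) * z
    ≡⟨ cong (λ y′ → (1ℚ + (1ℚ + B)) + (y′ + B * (1ℚ + z)) - (1ℚ + B) * z) y≡z+W ⟩
  (1ℚ + (1ℚ + B)) + (z + W + B * (1ℚ + z)) - (1ℚ + B) * z  ≡⟨ solve (z ∷ B ∷ W ∷ []) ℚ-ring ⟩
  two + two * B + W                                        ∎
  where open ≡-Reasoning

module BristleTarget {c b x : ℕ} {g : ℕ → ℚ} (fs : BroomFirstStep c (suc b) x g)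
                    (x∈ : InRange (suc (suc c)) (suc b) x) where
  open BroomFirstStep fs

  private
    B = fromℕ b
    W = fromℕ (2 ℕ.* c ℕ.+ 1)
    E = fromℕ (edgeSquares 1 c)
    V = 2 ℕ.* suc c ℕ.+ (2 ℕ.* b ℕ.+ 1)

    off-handle : ∀ {i} → i ≤ suc c → x ≢ i
    off-handle i≤c+1 x≡i = ℕ.<-irrefl (sym x≡i) (ℕ.≤-<-trans i≤c+1 (proj₁ x∈))

  other-bristles : sumFrom (suc (suc c)) (suc b) g ≡ B * (1ℚ + g 0)
  other-bristles = sumFrom-const-except g (1ℚ + g 0) x∈ (λ j∈ j≢x → at-bristle j∈ (j≢x ∘ sym)) at-target

  handle-sweep : g 1 ≡ g 0 + W × g (suc c) + two * sumFrom 1 c g ≡ W * g 1 + E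
  handle-sweep = sweep-down g (at-tip (off-handle ℕ.≤-refl)) c 0 refl
                   λ _ i<c → at-inner i<c (off-handle (s≤s (ℕ.<⇒≤ i<c)))

  hub-balanced : g 0 ≡ two + two * B + W
  hub-balanced = bristle-balance {B} {g 1} {g 0} {W} (proj₁ handle-sweep)
    (trans (at-hub (off-handle z≤n)) (cong (λ s → (1ℚ + (1ℚ + B)) + (g 1 + s)) other-bristles))

  hub-value : g 0 ≡ fromℕ V
  hub-value = begin
    g 0                                          ≡⟨ hub-balanced ⟩
    two + two * B + W                            ≡⟨ cong (two + two * B +_) (fromℕ-2*+ c 1) ⟩
    two + two * B + (two * fromℕ c + 1ℚ)         ≡⟨ regroup B (fromℕ c) ⟩
    two * (1ℚ + fromℕ c) + (two * B + 1ℚ)        ≡⟨ cong (two * fromℕ (suc c) +_) (fromℕ-2*+ b 1) ⟨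
    two * fromℕ (suc c) + fromℕ (2 ℕ.* b ℕ.+ 1)  ≡⟨ fromℕ-2*+ (suc c) (2 ℕ.* b ℕ.+ 1) ⟨
    fromℕ V                                      ∎
    where
    open ≡-Reasoning
    regroup : ∀ B C → two + two * B + (two * C + 1ℚ) ≡ two * (1ℚ + C) + (two * B + 1ℚ)
    regroup = solve-∀ ℚ-ring

  joinSum-on-bristle : joinSum c (suc b) g ≡ fromℕ (bristleJoin b (suc c))
  joinSum-on-bristle = begin
    (1ℚ + (1ℚ + B)) * g 0 + sumFrom (suc (suc c)) (suc b) g + (two * sumFrom 1 c g + g (suc c))
      ≡⟨ cong₂ (λ s t → (1ℚ + (1ℚ + B)) * g 0 + s + t) other-bristles
               (trans (ℚ.+-comm (two * sumFrom 1 c g) (g (suc c))) (proj₂ handle-sweep)) ⟩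
    (1ℚ + (1ℚ + B)) * g 0 + B * (1ℚ + g 0) + (W * g 1 + E)
      ≡⟨ cong (λ y → (1ℚ + (1ℚ + B)) * g 0 + B * (1ℚ + g 0) + (W * y + E)) (proj₁ handle-sweep) ⟩
    (1ℚ + (1ℚ + B)) * g 0 + B * (1ℚ + g 0) + (W * (g 0 + W) + E)
      ≡⟨ regroup B (g 0) W E ⟩
    B + (two + two * B + W) * g 0 + (E + W * W)
      ≡⟨ cong (λ y → B + y * g 0 + (E + W * W)) hub-balanced ⟨
    B + g 0 * g 0 + (E + W * W)
      ≡⟨ cong₂ (λ y z → B + y * z + (E + W * W)) hub-value hub-value ⟩
    B + fromℕ V * fromℕ V + (E + W * W)
      ≡⟨ cong₂ (λ y z → B + y + z) (fromℕ-* V V) (fromℕ-edgeSquares-snoc 1 c) ⟨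
    B + fromℕ (V ℕ.* V) + fromℕ (edgeSquares 1 (suc c))
      ≡⟨ cong (_+ fromℕ (edgeSquares 1 (suc c))) (fromℕ-+ b (V ℕ.* V)) ⟨
    fromℕ (b ℕ.+ V ℕ.* V) + fromℕ (edgeSquares 1 (suc c))
      ≡⟨ fromℕ-+ (b ℕ.+ V ℕ.* V) _ ⟨
    fromℕ (bristleJoin b (suc c))                ∎
    where
    open ≡-Reasoning
    regroup : ∀ B g0 W E → (1ℚ + (1ℚ + B)) * g0 + B * (1ℚ + g0) + (W * (g0 + W) + E) ≡
                           B + (two + two * B + W) * g0 + (E + W * W)
    regroup = solve-∀ ℚ-ring

joinSum-≤ : ∀ {c b g} x → BroomFirstStep c (suc b) x g → x < suc (suc c) ℕ.+ suc b →
            joinSum c (suc b) g ℚ.≤ fromℕ (broomMaxJoin (suc b) (suc c))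
joinSum-≤ {c} {b} {g} x fs x<n with x ℕ.≤? suc c
... | yes x≤c+1 with ℕ.m≤n⇒∃[o]m+o≡n x≤c+1
... | m , x+m≡c+1 = begin
  joinSum c (suc b) g                        ≡⟨ joinSum-on-handle x fs x+m≡c+1 ⟩
  fromℕ (handleJoin (suc b) x m)             ≤⟨ fromℕ-mono-≤ (handleJoin-≤ (suc b) x m) ⟩
  fromℕ (broomMaxJoin (suc b) (x ℕ.+ m))     ≡⟨ cong (fromℕ ∘ broomMaxJoin (suc b)) x+m≡c+1 ⟩
  fromℕ (broomMaxJoin (suc b) (suc c))       ∎
  where
  open ℚ.≤-Reasoning
joinSum-≤ {c} {b} {g} x fs x<n | no x≰c+1 = begin
  joinSum c (suc b) g                        ≡⟨ BristleTarget.joinSum-on-bristle fs (ℕ.≰⇒> x≰c+1 , x<n) ⟩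
  fromℕ (bristleJoin b (suc c))              ≤⟨ fromℕ-mono-≤ (bristleJoin-≤ b c) ⟩
  fromℕ (broomMaxJoin (suc b) (suc c))       ∎
  where open ℚ.≤-Reasoning

maxJ-broom′ : ∀ {c b h} → IsHittingTime (suc (suc c) ℕ.+ suc b) (suc (suc c)) h →
              maxJ (suc (suc c) ℕ.+ suc b) (suc (suc c)) h ≡ fromℕ (broomMaxJoin (suc b) (suc c))
maxJ-broom′ {c} {b} {h} hitting = ℚ.≤-antisym
  (maxᵥ-≤ (suc c ℕ.+ suc b) (J n d h) J-≤)
  (ℚ.≤-trans (ℚ.≤-reflexive (sym J-at-tip)) (≤-maxᵥ n (J n d h) tip))
  where
  d = suc (suc c)
  n = d ℕ.+ suc b
  c+1<n : suc c < n
  c+1<n = handle<n ℕ.≤-refl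
  tip = fromℕ< c+1<n
  J-≤ : ∀ v → J n d h v ℚ.≤ fromℕ (broomMaxJoin (suc b) (suc c))
  J-≤ v = ℚ.≤-trans (ℚ.≤-reflexive (J≡joinSum hitting v))
                    (joinSum-≤ (toℕ v) (broomFirstStep hitting v) (Fin.toℕ<n v))
  J-at-tip : J n d h tip ≡ fromℕ (broomMaxJoin (suc b) (suc c))
  J-at-tip = begin
    J n d h tip                                   ≡⟨ J≡joinSum hitting tip ⟩
    joinSum c (suc b) _
      ≡⟨ joinSum-on-handle (toℕ tip) (broomFirstStep hitting tip) (trans (ℕ.+-identityʳ _) (Fin.toℕ-fromℕ< c+1<n)) ⟩
    fromℕ (handleJoin (suc b) (toℕ tip) 0)        ≡⟨ cong (λ x → fromℕ (handleJoin (suc b) x 0)) (Fin.toℕ-fromℕ< c+1<n) ⟩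
    fromℕ (broomMaxJoin (suc b) (suc c) ℕ.+ 0)    ≡⟨ cong fromℕ (ℕ.+-identityʳ (broomMaxJoin (suc b) (suc c))) ⟩
    fromℕ (broomMaxJoin (suc b) (suc c))          ∎
    where open ≡-Reasoning

maxJ-broom : ∀ {n d h} → 2 ≤ d → d < n → IsHittingTime n d h →
             maxJ n d h ≡ fromℕ (broomMaxJoin (n ∸ d) (d ∸ 1))
maxJ-broom {d = suc (suc c)} (s≤s (s≤s z≤n)) d<n hitting with ℕ.m≤n⇒∃[o]m+o≡n d<n
... | b , d+1+b≡n with trans (ℕ.+-suc (suc (suc c)) b) d+1+b≡n
... | refl = trans (maxJ-broom′ hitting)
                   (cong (λ k → fromℕ (broomMaxJoin k (suc c))) (sym (ℕ.m+n∸m≡n (suc (suc c)) (suc b))))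

corollary3p5 : (n d d′ : ℕ) → 2 ≤ d → d < d′ → d′ < n →
    (h h′ : Fin n → Fin n → ℚ) → IsHittingTime n d h → IsHittingTime n d′ h′ →
    maxJ n d h Data.Rational.< maxJ n d′ h′
corollary3p5 n d d′ 2≤d d<d′ d′<n h h′ hitting hitting′ = begin-strict
  maxJ n d h                              ≡⟨ maxJ-broom 2≤d (ℕ.<-trans d<d′ d′<n) hitting ⟩
  fromℕ (broomMaxJoin (n ∸ d) (d ∸ 1))    <⟨ fromℕ-mono-< (broomMaxJoin-∸-strictMono 1≤d d<d′ d′<n) ⟩
  fromℕ (broomMaxJoin (n ∸ d′) (d′ ∸ 1))  ≡⟨ maxJ-broom (ℕ.≤-trans 2≤d (ℕ.<⇒≤ d<d′)) d′<n hitting′ ⟨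
  maxJ n d′ h′                            ∎
  where
  open ℚ.≤-Reasoning
  1≤d : 1 ≤ d
  1≤d = ℕ.≤-trans (ℕ.n≤1+n 1) 2≤d
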